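{- Let $n$ be sufficiently large, $k=\lceil n^{1/3}\rceil$, and $x_i=2k^2-2(i-1)k-1$ for $i=1,\dots,k$. Let $k'=\min\{j:\sum_{i=1}^j x_i\ge n\}$, and set $|P_i|=x_i$ for $i<k'$ and $|P_{k'}|=n-\sum_{i=1}^{k'-1}x_i$. Let $\pi$ be the permutation of $[n]$ formed by consecutive blocks of positions $P_1,\dots,P_{k'}$ (in this order, $P_i$ consisting of $|P_i|$ consecutive positions), where on each block $\pi$ is increasing and takes consecutive values, and all values on $P_{i+1}$ are smaller than all values on $P_i$ (so $P_1$ receives the top $x_1$ values $n-x_1+1,\dots,n$, $P_2$ the next $x_2$ values, etc.). Let $(A,B)$ be weak twins in $\pi$ with $|A|=|B|\ge n/2-k/3$. Then for all $1\le i<k'$, $|A\cap P_i|=|B\cap P_i|$ (where $A\cap P_i$ denotes the set of positions of $A$ lying in $P_i$).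
   Context: The shape of a sequence $(x_1,\dots,x_w)$ of distinct integers is $(s_1,\dots,s_{w-1})\in\{+,-\}^{w-1}$ with $s_i=+$ iff $x_i<x_{i+1}$. A sub-permutation of $\pi$ is a subsequence $(\pi(i_1),\dots,\pi(i_j))$ with $i_1<\dots<i_j$. Weak twins are two sub-permutations of $\pi$ with disjoint position sets and the same shape; their length is the length of one of them. -}

module Defs where

open import Data.Nat using (ℕ; zero; suc; _+_; _*_; _∸_; _^_; _≤_; _<_; _<ᵇ_; _≤ᵇ_)
open import Data.Bool using (Bool; true; false; _∧_; if_then_else_)
open import Data.List using (List; []; _∷_; _++_; map; applyUpTo; length)
open import Data.Nat.ListAction using (sum)
open import Data.List.Relation.Unary.All using (All)
open import Data.List.Relation.Unary.Linked using (Linked)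
open import Data.List.Membership.Propositional using (_∈_; _∉_)
open import Data.Product using (_×_)
open import Relation.Binary.PropositionalEquality using (_≡_)

IsCeilCbrt : ℕ → ℕ → Set
IsCeilCbrt n k = (n ≤ k ^ 3) × (∀ j → n ≤ j ^ 3 → k ≤ j)

-- x_i = 2k² - 2(i-1)k - 1   (positive for 1 ≤ i ≤ k)
xs : ℕ → ℕ → ℕ
xs k i = 2 * k * k ∸ 2 * (i ∸ 1) * k ∸ 1

S : ℕ → ℕ → ℕ
S k j = sum (applyUpTo (λ t → xs k (suc t)) j)

IsKPrime : ℕ → ℕ → ℕ → Set
IsKPrime n k k' = (1 ≤ k') × (k' ≤ k) × (n ≤ S k k')
                × (∀ j → j ≤ k → n ≤ S k j → k' ≤ j)

blockSizes : ℕ → ℕ → ℕ → List ℕ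
blockSizes n k k' = applyUpTo (λ t → xs k (suc t)) (k' ∸ 1) ++ (n ∸ S k (k' ∸ 1) ∷ [])

-- the values of consecutive blocks; `top` is the largest value still unused.
-- A block of size s receives the values top-s+1, ..., top in increasing order.
blockValues : ℕ → List ℕ → List ℕ
blockValues top [] = []
blockValues top (s ∷ ss) =
  applyUpTo (λ j → top ∸ s + 1 + j) s ++ blockValues (top ∸ s) ss

-- the permutation π of [n] as the list (π(1), ..., π(n)); values in 1..n
perm : ℕ → ℕ → ℕ → List ℕ
perm n k k' = blockValues n (blockSizes n k k')

-- π at (0-indexed) position p (default 0 outside the range; never used
-- for positions in range)
at : List ℕ → ℕ → ℕ
at [] p = 0
at (v ∷ vs) zero = v
at (v ∷ vs) (suc p) = at vs p

-- shape of a sequence: true = '+', false = '-'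
shape : List ℕ → List Bool
shape [] = []
shape (a ∷ []) = []
shape (a ∷ b ∷ r) = (a <ᵇ b) ∷ shape (b ∷ r)

-- A sub-permutation is given by its strictly increasing list of
-- (0-indexed) positions i_1 < ... < i_j, all < n.
IsPositionList : ℕ → List ℕ → Set
IsPositionList n A = Linked _<_ A × All (_< n) A

WeakTwins : (n : ℕ) → List ℕ → List ℕ → List ℕ → Set
WeakTwins n π A B =
  IsPositionList n A × IsPositionList n B
  × (∀ p → p ∈ A → p ∉ B)
  × (length A ≡ length B)
  × (shape (map (at π) A) ≡ shape (map (at π) B))

countIn : ℕ → ℕ → List ℕ → ℕ
countIn lo hi [] = 0
countIn lo hi (p ∷ ps) =
  (if (lo ≤ᵇ p) ∧ (p <ᵇ hi) then 1 else 0) + countIn lo hi ps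

-- |A ∩ P_i| for 1 ≤ i < k': P_i = positions S(i-1) ≤ p < S(i) (0-indexed)
blockCount : ℕ → ℕ → List ℕ → ℕ
blockCount k i A = countIn (S k (i ∸ 1)) (S k i) A

-- Let r_X(p) be the number of positions of X below p. In π, positions p < q satisfy
-- π(p) < π(q) exactly when they lie in the same block, so equal shapes say that consecutive
-- entries of A share a block iff the corresponding entries of B do. By induction on i < k′,
-- r_A and r_B agree at the end S(i) of P_i. For the step, A has an entry in P_{i+1}:
-- otherwise the c entries of B in P_{i+1} force the c entries of A with the same indices,
-- all beyond P_{i+1}, into one later block, so c ≤ x_{i+2} = x_{i+1} − 2k; then at least 2k
-- positions of P_{i+1} lie in neither A nor B, so 2|A| + 2k ≤ n, against |A| ≥ n/2 − k/3.
-- Hence if r_A(S(i+1)) < r_B(S(i+1)), the last entry of A in P_{i+1} and the next one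
-- straddle the end of P_{i+1}, while the entries of B with the same indices both lie in
-- P_{i+1}, contradicting the equal shapes.

module Submission where

open import Defs
open import Data.Bool using (T; if_then_else_)
open import Data.List using (List; []; _∷_; [_]; _++_; map; applyUpTo; length; take)
open import Data.List.Membership.Propositional using (_∈_; _∉_)
open import Data.List.Properties using (∷-injective; length-++; length-applyUpTo; applyUpTo-∷ʳ; take-all)
open import Data.List.Relation.Unary.All as All using (All; []; _∷_)
open import Data.List.Relation.Unary.AllPairs using (_∷_)
open import Data.List.Relation.Unary.Any using (here; there)
open import Data.List.Relation.Unary.Linked as Linked using (Linked; [-]; _∷_)
open import Data.List.Relation.Unary.Linked.Properties using (Linked⇒AllPairs)
open import Data.Nat using (ℕ; zero; suc; _+_; _*_; _∸_; _≤_; _<_; z≤n; s≤s; z<s)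
open import Data.Nat.ListAction using (sum)
open import Data.Nat.ListAction.Properties using (sum-++)
open import Data.Nat.Properties
open import Algebra.Properties.CommutativeSemigroup +-commutativeSemigroup using (interchange)
open import Data.Nat.Tactic.RingSolver using (solve-∀)
open import Data.Product using (_×_; _,_; proj₁; proj₂; ∃-syntax)
open import Function using (_∘_; _⇔_; mk⇔; Equivalence)
open import Function.Properties.Equivalence using () renaming (sym to ⇔-sym; trans to ⇔-trans)
open import Relation.Binary.Definitions using (tri<; tri≈; tri>)
open import Relation.Binary.PropositionalEquality hiding ([_])
open import Relation.Nullary using (¬_; Dec; yes; no; does; contradiction)
open import Relation.Nullary.Decidable using (_×-dec_)

-- Increasing position lists

head<tail : ∀ {p} {X : List ℕ} → Linked _<_ (p ∷ X) → All (p <_) X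
head<tail lk with p<X ∷ _ ← Linked⇒AllPairs <-trans lk = p<X

head≤all : ∀ {a X} → Linked _<_ (a ∷ X) → All (a ≤_) (a ∷ X)
head≤all ↗aX = ≤-refl ∷ All.map <⇒≤ (head<tail ↗aX)

at-All : ∀ {P : ℕ → Set} {X j} → All P X → j < length X → P (at X j)
at-All {j = zero} (px ∷ _) _ = px
at-All {j = suc j} (_ ∷ pxs) (s≤s j<) = at-All pxs j<

at<at-suc : ∀ {X j} → Linked _<_ X → suc j < length X → at X j < at X (suc j)
at<at-suc {j = zero} (x<y ∷ _) _ = x<y
at<at-suc {j = suc j} (_ ∷ ↗X) (s≤s j<) = at<at-suc ↗X j<
at<at-suc [-] (s≤s ())

at+≤at-+ : ∀ {X} → Linked _<_ X → ∀ j d → j + d < length X → at X j + d ≤ at X (j + d)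
at+≤at-+ {X} ↗X j zero _ rewrite +-identityʳ j | +-identityʳ (at X j) = ≤-refl
at+≤at-+ {X} ↗X j (suc d) j+d< rewrite +-suc j d | +-suc (at X j) d =
  <-≤-trans (s≤s (at+≤at-+ ↗X j d (<-trans (n<1+n (j + d)) j+d<))) (at<at-suc ↗X j+d<)

at-++ˡ : ∀ xs ys {p} → p < length xs → at (xs ++ ys) p ≡ at xs p
at-++ˡ (x ∷ xs) ys {zero} _ = refl
at-++ˡ (x ∷ xs) ys {suc p} (s≤s p<) = at-++ˡ xs ys p<

at-++ʳ : ∀ xs ys p → at (xs ++ ys) (length xs + p) ≡ at ys p
at-++ʳ [] ys p = refl
at-++ʳ (x ∷ xs) ys p = at-++ʳ xs ys p

at-applyUpTo : ∀ f {s p} → p < s → at (applyUpTo f s) p ≡ f p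
at-applyUpTo f {suc s} {zero} _ = refl
at-applyUpTo f {suc s} {suc p} (s≤s p<s) = at-applyUpTo (f ∘ suc) p<s

take-applyUpTo-++ : ∀ (f : ℕ → ℕ) {m j} ys → j ≤ m → take j (applyUpTo f m ++ ys) ≡ applyUpTo f j
take-applyUpTo-++ f {j = zero} ys _ = refl
take-applyUpTo-++ f {suc m} {suc j} ys (s≤s j≤m) = cong (f 0 ∷_) (take-applyUpTo-++ (f ∘ suc) ys j≤m)

-- Counting positions in an interval

-- `does (inInterval? lo hi p)` computes to the boolean tested in `countIn`.
private
  inInterval? : ∀ lo hi p → Dec (lo ≤ p × p < hi)
  inInterval? lo hi p = lo ≤? p ×-dec p <? hi

  indicator-yes : ∀ {P : Set} (d : Dec P) → P → (if does d then 1 else 0) ≡ 1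
  indicator-yes (yes _) _ = refl
  indicator-yes (no ¬p) p = contradiction p ¬p

  indicator-no : ∀ {P : Set} (d : Dec P) → ¬ P → (if does d then 1 else 0) ≡ 0
  indicator-no (yes p) ¬p = contradiction p ¬p
  indicator-no (no _) _ = refl

countIn-here : ∀ {lo hi p} ps → lo ≤ p → p < hi → countIn lo hi (p ∷ ps) ≡ suc (countIn lo hi ps)
countIn-here {lo} {hi} {p} ps lo≤p p<hi =
  cong (_+ countIn lo hi ps) (indicator-yes (inInterval? lo hi p) (lo≤p , p<hi))

countIn-skip : ∀ {lo hi p} ps → ¬ (lo ≤ p × p < hi) → countIn lo hi (p ∷ ps) ≡ countIn lo hi ps
countIn-skip {lo} {hi} {p} ps p∉ = cong (_+ countIn lo hi ps) (indicator-no (inInterval? lo hi p) p∉)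

countIn-none : ∀ {lo hi} {X : List ℕ} → All (λ p → ¬ (lo ≤ p × p < hi)) X → countIn lo hi X ≡ 0
countIn-none [] = refl
countIn-none {X = _ ∷ X} (p∉ ∷ ps∉) = trans (countIn-skip X p∉) (countIn-none ps∉)

countIn-≥hi : ∀ {lo hi} {X : List ℕ} → All (hi ≤_) X → countIn lo hi X ≡ 0
countIn-≥hi = countIn-none ∘ All.map (λ hi≤p (_ , p<hi) → <⇒≱ p<hi hi≤p)

countIn-empty : ∀ lo (X : List ℕ) → countIn lo lo X ≡ 0
countIn-empty lo X = countIn-none (All.universal (λ p (lo≤p , p<lo) → <⇒≱ p<lo lo≤p) X)

countIn-all : ∀ {lo hi} {X : List ℕ} → All (λ p → lo ≤ p × p < hi) X → countIn lo hi X ≡ length X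
countIn-all [] = refl
countIn-all {X = _ ∷ X} ((lo≤p , p<hi) ∷ ps) = trans (countIn-here X lo≤p p<hi) (cong suc (countIn-all ps))

countIn-≤-length : ∀ lo hi (X : List ℕ) → countIn lo hi X ≤ length X
countIn-≤-length lo hi [] = z≤n
countIn-≤-length lo hi (p ∷ X) with inInterval? lo hi p
... | yes (lo≤p , p<hi) = ≤-trans (≤-reflexive (countIn-here X lo≤p p<hi)) (s≤s (countIn-≤-length lo hi X))
... | no p∉ = ≤-trans (≤-reflexive (countIn-skip X p∉)) (m≤n⇒m≤1+n (countIn-≤-length lo hi X))

countIn-split : ∀ {lo mid hi} → lo ≤ mid → mid ≤ hi →
  ∀ X → countIn lo hi X ≡ countIn lo mid X + countIn mid hi X
countIn-split _ _ [] = refl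
countIn-split {lo} {mid} {hi} lo≤mid mid≤hi (p ∷ X) with inInterval? lo mid p | inInterval? mid hi p
... | yes (lo≤p , p<mid) | _
  rewrite countIn-here X lo≤p (<-≤-trans p<mid mid≤hi) | countIn-here X lo≤p p<mid
        | countIn-skip {mid} {hi} X (λ (mid≤p , _) → <⇒≱ p<mid mid≤p)
  = cong suc (countIn-split lo≤mid mid≤hi X)
... | no _ | yes (mid≤p , p<hi)
  rewrite countIn-here X (≤-trans lo≤mid mid≤p) p<hi | countIn-here X mid≤p p<hi
        | countIn-skip {lo} {mid} X (λ (_ , p<mid) → <⇒≱ p<mid mid≤p)
  = trans (cong suc (countIn-split lo≤mid mid≤hi X)) (sym (+-suc _ _))
... | no p∉ˡ | no p∉ʳ
  = trans (countIn-skip X p∉)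
      (trans (countIn-split lo≤mid mid≤hi X) (sym (cong₂ _+_ (countIn-skip X p∉ˡ) (countIn-skip X p∉ʳ))))
  where
  p∉ : ¬ (lo ≤ p × p < hi)
  p∉ (lo≤p , p<hi) with p <? mid
  ... | yes p<mid = p∉ˡ (lo≤p , p<mid)
  ... | no p≮mid = p∉ʳ (≮⇒≥ p≮mid , p<hi)

countIn-pos⇒∈ : ∀ {lo hi} (X : List ℕ) → 0 < countIn lo hi X → ∃[ p ] p ∈ X × lo ≤ p × p < hi
countIn-pos⇒∈ {lo} {hi} (p ∷ X) pos with inInterval? lo hi p
... | yes p∈ = p , here refl , p∈
... | no p∉ with q , q∈X , q∈ ← countIn-pos⇒∈ X (<-≤-trans pos (≤-reflexive (countIn-skip X p∉))) =
  q , there q∈X , q∈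

countIn-interval-≡ : ∀ {lo hi} (A B : List ℕ) → lo ≤ hi →
  countIn 0 lo A ≡ countIn 0 lo B → countIn 0 hi A ≡ countIn 0 hi B → countIn lo hi A ≡ countIn lo hi B
countIn-interval-≡ {lo} {hi} A B lo≤hi below above = +-cancelˡ-≡ (countIn 0 lo A) _ _ (begin
  countIn 0 lo A + countIn lo hi A  ≡⟨ countIn-split z≤n lo≤hi A ⟨
  countIn 0 hi A                    ≡⟨ above ⟩
  countIn 0 hi B                    ≡⟨ countIn-split z≤n lo≤hi B ⟩
  countIn 0 lo B + countIn lo hi B  ≡⟨ cong (_+ countIn lo hi B) below ⟨
  countIn 0 lo A + countIn lo hi B  ∎)
  where open ≡-Reasoning

countIn-singleton-≤1 : ∀ h {X} → Linked _<_ X → countIn h (suc h) X ≤ 1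
countIn-singleton-≤1 h {[]} _ = z≤n
countIn-singleton-≤1 h {p ∷ X} lk with p ≟ h
... | yes refl = ≤-reflexive (trans (countIn-here X ≤-refl ≤-refl) (cong suc (countIn-≥hi (head<tail lk))))
... | no p≢h = ≤-trans (≤-reflexive (countIn-skip X p∉)) (countIn-singleton-≤1 h (Linked.tail lk))
  where
  p∉ : ¬ (h ≤ p × p < suc h)
  p∉ (h≤p , p≤h) = p≢h (≤-antisym (≤-pred p≤h) h≤p)

countIn-disjoint : ∀ {A B} → Linked _<_ A → Linked _<_ B → (∀ p → p ∈ A → p ∉ B) →
  ∀ lo d → countIn lo (lo + d) A + countIn lo (lo + d) B ≤ d
countIn-disjoint {A} {B} _ _ _ lo zero
  rewrite +-identityʳ lo | countIn-empty lo A | countIn-empty lo B = z≤n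
countIn-disjoint {A} {B} ↗A ↗B A∩B=∅ lo (suc d) = begin
  countIn lo (lo + suc d) A + countIn lo (lo + suc d) B
    ≡⟨ cong₂ _+_ (split A) (split B) ⟩
  (countIn lo h A + a) + (countIn lo h B + b)
    ≡⟨ interchange (countIn lo h A) a (countIn lo h B) b ⟩
  (countIn lo h A + countIn lo h B) + (a + b)
    ≤⟨ +-mono-≤ (countIn-disjoint ↗A ↗B A∩B=∅ lo d) unit ⟩
  d + 1
    ≡⟨ +-comm d 1 ⟩
  suc d ∎
  where
  open ≤-Reasoning
  h a b : ℕ
  h = lo + d
  a = countIn h (suc h) A
  b = countIn h (suc h) B
  split : ∀ X → countIn lo (lo + suc d) X ≡ countIn lo h X + countIn h (suc h) X
  split X rewrite +-suc lo d = countIn-split (m≤m+n lo d) (n≤1+n h) X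
  only-h : ∀ X → 0 < countIn h (suc h) X → h ∈ X
  only-h X pos with p , p∈X , h≤p , p≤h ← countIn-pos⇒∈ X pos =
    subst (_∈ X) (≤-antisym (≤-pred p≤h) h≤p) p∈X
  unit : a + b ≤ 1
  unit with a in a≡
  ... | zero = countIn-singleton-≤1 h ↗B
  ... | suc _ with b in b≡
  ...   | zero = ≤-trans (≤-reflexive (trans (+-identityʳ _) (sym a≡))) (countIn-singleton-≤1 h ↗A)
  ...   | suc _ = contradiction (only-h B (subst (0 <_) (sym b≡) z<s))
                                (A∩B=∅ h (only-h A (subst (0 <_) (sym a≡) z<s)))

disjoint-length-bound : ∀ {n A B} → Linked _<_ A → Linked _<_ B → (∀ p → p ∈ A → p ∉ B) →
  All (_< n) A → All (_< n) B → ∀ lo x → lo + x ≤ n →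
  length A + length B + x ≤ countIn lo (lo + x) A + countIn lo (lo + x) B + n
disjoint-length-bound {n} {A} {B} ↗A ↗B A∩B=∅ A<n B<n lo x lo+x≤n
  with y , refl ← m≤n⇒∃[o]m+o≡n lo+x≤n = begin
  length A + length B + x
    ≡⟨ cong₂ (λ a b → a + b + x) (thirds A A<n) (thirds B B<n) ⟩
  (a₀ + a + a₂) + (b₀ + b + b₂) + x
    ≡⟨ regroup a₀ a a₂ b₀ b b₂ x ⟩
  (a₀ + b₀) + (a₂ + b₂) + (a + b + x)
    ≤⟨ +-monoˡ-≤ (a + b + x) (+-mono-≤ (countIn-disjoint ↗A ↗B A∩B=∅ 0 lo)
                                        (countIn-disjoint ↗A ↗B A∩B=∅ hi y)) ⟩
  lo + y + (a + b + x)
    ≡⟨ regroup′ lo y a b x ⟩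
  a + b + (lo + x + y) ∎
  where
  open ≤-Reasoning
  hi a₀ a a₂ b₀ b b₂ : ℕ
  hi = lo + x
  a₀ = countIn 0 lo A
  a = countIn lo hi A
  a₂ = countIn hi (hi + y) A
  b₀ = countIn 0 lo B
  b = countIn lo hi B
  b₂ = countIn hi (hi + y) B
  thirds : ∀ X → All (_< hi + y) X →
    length X ≡ countIn 0 lo X + countIn lo hi X + countIn hi (hi + y) X
  thirds X X<n = begin-equality
    length X                                                   ≡⟨ countIn-all (All.map (z≤n ,_) X<n) ⟨
    countIn 0 (hi + y) X                                       ≡⟨ countIn-split z≤n (m≤m+n hi y) X ⟩
    countIn 0 hi X + countIn hi (hi + y) X                     ≡⟨ cong (_+ countIn hi (hi + y) X)
                                                                       (countIn-split z≤n (m≤m+n lo x) X) ⟩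
    countIn 0 lo X + countIn lo hi X + countIn hi (hi + y) X   ∎
  regroup : ∀ a₀ a a₂ b₀ b b₂ x →
    (a₀ + a + a₂) + (b₀ + b + b₂) + x ≡ (a₀ + b₀) + (a₂ + b₂) + (a + b + x)
  regroup = solve-∀
  regroup′ : ∀ lo y a b x → lo + y + (a + b + x) ≡ a + b + (lo + x + y)
  regroup′ = solve-∀

-- Ranks

at<⇔<countIn : ∀ {X j} p → Linked _<_ X → j < length X → (at X j < p ⇔ j < countIn 0 p X)
at<⇔<countIn {a ∷ X} {j} p ↗aX j< with a <? p
... | yes a<p rewrite countIn-here X z≤n a<p = below j j<
  where
  below : ∀ j → j < suc (length X) → (at (a ∷ X) j < p ⇔ j < suc (countIn 0 p X))
  below zero _ = mk⇔ (λ _ → s≤s z≤n) (λ _ → a<p)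
  below (suc j) (s≤s j<) =
    mk⇔ (s≤s ∘ Equivalence.to IH) (Equivalence.from IH ∘ ≤-pred)
    where
    IH : at X j < p ⇔ j < countIn 0 p X
    IH = at<⇔<countIn p (Linked.tail ↗aX) j<
... | no a≮p rewrite countIn-≥hi {0} {p} (All.map (≤-trans (≮⇒≥ a≮p)) (head≤all ↗aX)) =
  mk⇔ (λ at<p → contradiction (≤-trans (≮⇒≥ a≮p) (at-All (head≤all ↗aX) j<)) (<⇒≱ at<p)) (λ ())

countIn≤⇒≤at : ∀ {X j} p → Linked _<_ X → j < length X → countIn 0 p X ≤ j → p ≤ at X j
countIn≤⇒≤at p ↗X j< c≤j = ≮⇒≥ (λ at<p → <⇒≱ (Equivalence.to (at<⇔<countIn p ↗X j<) at<p) c≤j)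

at-between : ∀ {X v} lo hi → Linked _<_ X → v < length X →
  countIn 0 lo X ≤ v → v < countIn 0 hi X → lo ≤ at X v × at X v < hi
at-between lo hi ↗X v< lo≤v v<hi =
  countIn≤⇒≤at lo ↗X v< lo≤v , Equivalence.from (at<⇔<countIn hi ↗X v<) v<hi

-- Shapes

sameShape-<-transfer : ∀ (f : ℕ → ℕ) {A B} → length A ≡ length B →
  shape (map f A) ≡ shape (map f B) → ∀ {j} → suc j < length A →
  f (at B j) < f (at B (suc j)) → f (at A j) < f (at A (suc j))
sameShape-<-transfer f {a ∷ a′ ∷ A} {b ∷ b′ ∷ B} _ same {zero} _ lt =
  <ᵇ⇒< _ _ (subst T (sym (proj₁ (∷-injective same))) (<⇒<ᵇ lt))
sameShape-<-transfer f {a ∷ a′ ∷ A} {b ∷ b′ ∷ B} same-len same {suc j} (s≤s j<) =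
  sameShape-<-transfer f (suc-injective same-len) (proj₂ (∷-injective same)) j<
sameShape-<-transfer f {a ∷ a′ ∷ A} {_ ∷ []} () _ _
sameShape-<-transfer f {a ∷ a′ ∷ A} {[]} () _ _
sameShape-<-transfer f {_ ∷ []} _ _ {_} (s≤s ())

WeakTwins-sym : ∀ {n π A B} → WeakTwins n π A B → WeakTwins n π B A
WeakTwins-sym (A-pos , B-pos , A∩B=∅ , same-length , same-shape) =
  B-pos , A-pos , (λ p p∈B p∈A → A∩B=∅ p p∈A p∈B) , sym same-length , sym same-shape

-- Blocks

-- `end j` is the first position after the j-th block, so p ≤ q share a block iff
-- no block ends in (p, q].
SameBlock : (ℕ → ℕ) → ℕ → ℕ → Set
SameBlock end p q = ∀ j → p < end j → q < end j

module _ {end : ℕ → ℕ} where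

  SameBlock-refl : ∀ {p} → SameBlock end p p
  SameBlock-refl _ p< = p<

  SameBlock-trans : ∀ {p q r} → SameBlock end p q → SameBlock end q r → SameBlock end p r
  SameBlock-trans pq qr j p< = qr j (pq j p<)

  SameBlock-within : (∀ {i j} → i ≤ j → end i ≤ end j) →
    ∀ {i p q} → end i ≤ p → q < end (suc i) → SameBlock end p q
  SameBlock-within mono {i} p≥ q< j p< with suc i ≤? j
  ... | yes i<j = <-≤-trans q< (mono i<j)
  ... | no i≮j = contradiction (≤-trans (mono (≤-pred (≰⇒> i≮j))) p≥) (<⇒≱ p<)

  SameBlock-chain : ∀ (f : ℕ → ℕ) t c → (∀ d → d < c → SameBlock end (f (t + d)) (f (suc (t + d)))) →
    SameBlock end (f t) (f (t + c))
  SameBlock-chain f t zero _ = subst (SameBlock end (f t) ∘ f) (sym (+-identityʳ t)) SameBlock-refl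
  SameBlock-chain f t (suc c) steps = subst (SameBlock end (f t) ∘ f) (sym (+-suc t c))
    (SameBlock-trans (SameBlock-chain f t c (λ d d<c → steps d (m<n⇒m<1+n d<c))) (steps c ≤-refl))

  SameBlock-width : ∀ {a w} → (∀ j → a ≤ j → end (suc j) ≤ end j + w) →
    ∀ d {p q} → end a ≤ p → SameBlock end p q → q < end (a + d) → q < p + w
  SameBlock-width {a} {w} short zero {p} a≤p _ q< =
    ≤-trans (<-≤-trans q< (≤-trans (≤-reflexive (cong end (+-identityʳ a))) a≤p)) (m≤m+n p w)
  SameBlock-width {a} {w} short (suc d) {p} {q} a≤p same q< with p <? end (suc a)
  ... | yes p<next = <-≤-trans (same (suc a) p<next) (≤-trans (short a ≤-refl) (+-monoˡ-≤ w a≤p))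
  ... | no p≮next = SameBlock-width (λ j a<j → short j (<⇒≤ a<j)) d (≮⇒≥ p≮next) same
                                    (<-≤-trans q< (≤-reflexive (cong end (+-suc a d))))

-- Layered permutations

blockEnds : List ℕ → ℕ → ℕ
blockEnds ss j = sum (take j ss)

m+n≤o⇒n≤o∸m : ∀ s {m top} → s + m ≤ top → m ≤ top ∸ s
m+n≤o⇒n≤o∸m s {m} s+m≤top = subst (_≤ _) (m+n∸m≡n s m) (∸-monoˡ-≤ s s+m≤top)

module _ (top s : ℕ) (ss : List ℕ) where

  blockValues-head : ∀ {p} → p < s → at (blockValues top (s ∷ ss)) p ≡ top ∸ s + 1 + p
  blockValues-head {p} p<s = begin
    at (first ++ blockValues (top ∸ s) ss) p  ≡⟨ at-++ˡ first _ (subst (p <_) (sym (length-applyUpTo _ s)) p<s) ⟩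
    at first p                                ≡⟨ at-applyUpTo _ p<s ⟩
    top ∸ s + 1 + p                           ∎
    where
    open ≡-Reasoning
    first : List ℕ
    first = applyUpTo (λ j → top ∸ s + 1 + j) s

  blockValues-tail : ∀ p → at (blockValues top (s ∷ ss)) (s + p) ≡ at (blockValues (top ∸ s) ss) p
  blockValues-tail p =
    subst (λ l → at (first ++ rest) (l + p) ≡ at rest p) (length-applyUpTo _ s) (at-++ʳ first rest p)
    where
    first rest : List ℕ
    first = applyUpTo (λ j → top ∸ s + 1 + j) s
    rest = blockValues (top ∸ s) ss

blockValues-≤ : ∀ top ss {p} → p < sum ss → sum ss ≤ top → at (blockValues top ss) p ≤ top
blockValues-≤ top (s ∷ ss) {p} p< ss≤top with p <? s
... | yes p<s rewrite blockValues-head top s ss p<s =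
  begin
    top ∸ s + 1 + p  ≡⟨ +-assoc (top ∸ s) 1 p ⟩
    top ∸ s + suc p  ≤⟨ +-monoʳ-≤ (top ∸ s) p<s ⟩
    top ∸ s + s      ≡⟨ m∸n+n≡m (≤-trans (m≤m+n s _) ss≤top) ⟩
    top              ∎
  where open ≤-Reasoning
... | no p≮s with p′ , refl ← m≤n⇒∃[o]m+o≡n (≮⇒≥ p≮s) rewrite blockValues-tail top s ss p′ =
  ≤-trans (blockValues-≤ (top ∸ s) ss (+-cancelˡ-< s _ _ p<) (m+n≤o⇒n≤o∸m s ss≤top)) (m∸n≤m top s)

SameBlock-∷ : ∀ s ss {p q} → SameBlock (blockEnds (s ∷ ss)) (s + p) (s + q) ⇔ SameBlock (blockEnds ss) p q
SameBlock-∷ s ss = mk⇔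
  (λ same j p< → +-cancelˡ-< s _ _ (same (suc j) (+-monoʳ-< s p<)))
  (λ { same zero () ; same (suc j) p< → +-monoʳ-< s (same j (+-cancelˡ-< s _ _ p<)) })

blockValues-<⇔SameBlock : ∀ top ss {p q} → p < q → q < sum ss → sum ss ≤ top →
  (at (blockValues top ss) p < at (blockValues top ss) q ⇔ SameBlock (blockEnds ss) p q)
blockValues-<⇔SameBlock top (s ∷ ss) {p} {q} p<q q< fits with q <? s
... | yes q<s = mk⇔ (λ _ → both-first) (λ _ → increasing)
  where
  both-first : SameBlock (blockEnds (s ∷ ss)) p q
  both-first zero ()
  both-first (suc j) _ = <-≤-trans q<s (m≤m+n s _)
  increasing : at (blockValues top (s ∷ ss)) p < at (blockValues top (s ∷ ss)) q
  increasing rewrite blockValues-head top s ss (<-trans p<q q<s) | blockValues-head top s ss q<s =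
    +-monoʳ-< (top ∸ s + 1) p<q
... | no q≮s with q′ , refl ← m≤n⇒∃[o]m+o≡n (≮⇒≥ q≮s) with p <? s
...   | yes p<s = mk⇔ (λ p<q → contradiction p<q (≤⇒≯ q-below-p))
                      (λ same → contradiction (same 1 (<-≤-trans p<s (≤-reflexive (sym (+-identityʳ s)))))
                                              (≤⇒≯ (≤-trans (≤-reflexive (+-identityʳ s)) (m≤m+n s q′))))
  where
  q-below-p : at (blockValues top (s ∷ ss)) (s + q′) ≤ at (blockValues top (s ∷ ss)) p
  q-below-p rewrite blockValues-tail top s ss q′ | blockValues-head top s ss p<s =
    ≤-trans (blockValues-≤ (top ∸ s) ss (+-cancelˡ-< s _ _ q<) (m+n≤o⇒n≤o∸m s fits))
            (≤-trans (m≤m+n (top ∸ s) 1) (m≤m+n _ p))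
...   | no p≮s with p′ , refl ← m≤n⇒∃[o]m+o≡n (≮⇒≥ p≮s)
  rewrite blockValues-tail top s ss p′ | blockValues-tail top s ss q′ =
  ⇔-trans (blockValues-<⇔SameBlock (top ∸ s) ss (+-cancelˡ-< s _ _ p<q) (+-cancelˡ-< s _ _ q<)
                                   (m+n≤o⇒n≤o∸m s fits))
          (⇔-sym (SameBlock-∷ s ss))

-- The block sizes x_i

xs-antitone : ∀ k {i j} → i ≤ j → xs k j ≤ xs k i
xs-antitone k i≤j =
  ∸-monoˡ-≤ 1 (∸-monoʳ-≤ (2 * k * k) (*-monoˡ-≤ k (*-monoʳ-≤ 2 (∸-monoˡ-≤ 1 i≤j))))

xs-gap : ∀ {k i} → 2 + i ≤ k → xs k (2 + i) + 2 * k ≡ xs k (1 + i)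
xs-gap {i = i} 2+i≤k with r , refl ← m≤n⇒∃[o]m+o≡n 2+i≤k = begin
  2 * K * K ∸ 2 * (1 + i) * K ∸ 1 + 2 * K    ≡⟨ cong (λ x → x ∸ 2 * (1 + i) * K ∸ 1 + 2 * K) (square i r) ⟩
  2 * (1 + i) * K + w ∸ 2 * (1 + i) * K ∸ 1 + 2 * K
                                              ≡⟨ cong (λ x → x ∸ 1 + 2 * K) (m+n∸m≡n (2 * (1 + i) * K) w) ⟩
  w ∸ 1 + 2 * K                               ≡⟨ +-comm (w ∸ 1) (2 * K) ⟩
  2 * K + (w ∸ 1)                             ≡⟨ +-∸-assoc (2 * K) {w} (s≤s z≤n) ⟨
  2 * K + w ∸ 1                               ≡⟨ cong (_∸ 1) (m+n∸m≡n (2 * i * K) (2 * K + w)) ⟨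
  2 * i * K + (2 * K + w) ∸ 2 * i * K ∸ 1     ≡⟨ cong (λ x → x ∸ 2 * i * K ∸ 1) (square′ i r) ⟨
  2 * K * K ∸ 2 * i * K ∸ 1                   ∎
  where
  open ≡-Reasoning
  K w : ℕ
  K = 2 + i + r
  w = 2 * (1 + r) * K
  square : ∀ i r → 2 * (2 + i + r) * (2 + i + r) ≡ 2 * (1 + i) * (2 + i + r) + 2 * (1 + r) * (2 + i + r)
  square = solve-∀
  square′ : ∀ i r →
    2 * (2 + i + r) * (2 + i + r) ≡ 2 * i * (2 + i + r) + (2 * (2 + i + r) + 2 * (1 + r) * (2 + i + r))
  square′ = solve-∀

S-suc : ∀ k j → S k (suc j) ≡ S k j + xs k (suc j)
S-suc k j = begin
  sum (applyUpTo f (suc j))     ≡⟨ cong sum (applyUpTo-∷ʳ f j) ⟨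
  sum (applyUpTo f j ++ [ f j ]) ≡⟨ sum-++ (applyUpTo f j) [ f j ] ⟩
  S k j + (f j + 0)             ≡⟨ cong (S k j +_) (+-identityʳ (f j)) ⟩
  S k j + f j                   ∎
  where
  open ≡-Reasoning
  f : ℕ → ℕ
  f t = xs k (suc t)

S-mono : ∀ k {i j} → i ≤ j → S k i ≤ S k j
S-mono k {i} i≤j with d , refl ← m≤n⇒∃[o]m+o≡n i≤j = extend d
  where
  extend : ∀ d → S k i ≤ S k (i + d)
  extend zero = ≤-reflexive (cong (S k) (sym (+-identityʳ i)))
  extend (suc d) rewrite +-suc i d | S-suc k (i + d) = ≤-trans (extend d) (m≤m+n _ _)

S-step-≤ : ∀ k {a j} → a ≤ j → S k (suc j) ≤ S k j + xs k (suc a)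
S-step-≤ k {j = j} a≤j = ≤-trans (≤-reflexive (S-suc k j)) (+-monoʳ-≤ (S k j) (xs-antitone k (s≤s a≤j)))

short-twins⇒k≡0 : ∀ {L n k} → 2 * L + 2 * k ≤ n → 3 * n ≤ 6 * L + 2 * k → k ≡ 0
short-twins⇒k≡0 {L} {n} {k} short big =
  n≤0⇒n≡0 (≤-trans (m≤m+n k (3 * k)) (+-cancelˡ-≤ (6 * L + 2 * k) _ _ (begin
  6 * L + 2 * k + 4 * k  ≡⟨ expand L k ⟩
  3 * (2 * L + 2 * k)    ≤⟨ *-monoʳ-≤ 3 short ⟩
  3 * n                  ≤⟨ big ⟩
  6 * L + 2 * k          ≡⟨ +-identityʳ _ ⟨
  6 * L + 2 * k + 0      ∎)))
  where
  open ≤-Reasoning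
  expand : ∀ L k → 6 * L + 2 * k + 4 * k ≡ 3 * (2 * L + 2 * k)
  expand = solve-∀

-- Weak twins in π

module Layered {n k m : ℕ} (k′-min : IsKPrime n k (suc m)) where

  π : List ℕ
  π = perm n k (suc m)

  sizes : List ℕ
  sizes = blockSizes n k (suc m)

  m<k : m < k
  m<k = proj₁ (proj₂ k′-min)

  n≤S : n ≤ S k (suc m)
  n≤S = proj₁ (proj₂ (proj₂ k′-min))

  S<n : S k m < n
  S<n = ≰⇒> (<-irrefl refl ∘ proj₂ (proj₂ (proj₂ k′-min)) m (<⇒≤ m<k))

  sum-sizes : sum sizes ≡ n
  sum-sizes = begin
    sum sizes                       ≡⟨ sum-++ (applyUpTo (λ t → xs k (suc t)) m) [ n ∸ S k m ] ⟩
    S k m + (n ∸ S k m + 0)         ≡⟨ cong (S k m +_) (+-identityʳ (n ∸ S k m)) ⟩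
    S k m + (n ∸ S k m)             ≡⟨ m+[n∸m]≡n (<⇒≤ S<n) ⟩
    n                               ∎
    where open ≡-Reasoning

  blockEnds-sizes-≤ : ∀ {j} → j ≤ m → blockEnds sizes j ≡ S k j
  blockEnds-sizes-≤ j≤m = cong sum (take-applyUpTo-++ (λ t → xs k (suc t)) [ n ∸ S k m ] j≤m)

  blockEnds-sizes-> : ∀ {j} → m < j → blockEnds sizes j ≡ n
  blockEnds-sizes-> {j} m<j =
    trans (cong sum (take-all j sizes (≤-trans (≤-reflexive length-sizes) m<j))) sum-sizes
    where
    length-sizes : length sizes ≡ suc m
    length-sizes = trans (length-++ (applyUpTo _ m)) (trans (cong (_+ 1) (length-applyUpTo _ m)) (+-comm m 1))

  -- The blocks of π end at S k 1, …, S k m and n; the ends S k j with j > m lie at or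
  -- beyond n and so separate no positions of π.
  perm-<⇔SameBlock : ∀ {p q} → p < q → q < n → (at π p < at π q ⇔ SameBlock (S k) p q)
  perm-<⇔SameBlock {p} {q} p<q q<n =
    ⇔-trans (blockValues-<⇔SameBlock n sizes p<q (<-≤-trans q<n (≤-reflexive (sym sum-sizes)))
                                                  (≤-reflexive sum-sizes))
            (mk⇔ to from)
    where
    to : SameBlock (blockEnds sizes) p q → SameBlock (S k) p q
    to same j p< with j ≤? m
    ... | yes j≤m = subst (q <_) (blockEnds-sizes-≤ j≤m)
                      (same j (subst (p <_) (sym (blockEnds-sizes-≤ j≤m)) p<))
    ... | no j≰m = <-≤-trans q<n (≤-trans n≤S (S-mono k (≰⇒> j≰m)))
    from : SameBlock (S k) p q → SameBlock (blockEnds sizes) p q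
    from same j p< with j ≤? m
    ... | yes j≤m = subst (q <_) (sym (blockEnds-sizes-≤ j≤m))
                      (same j (subst (p <_) (blockEnds-sizes-≤ j≤m) p<))
    ... | no j≰m = subst (q <_) (sym (blockEnds-sizes-> (≰⇒> j≰m))) q<n

  module Twins {A B : List ℕ} (twins : WeakTwins n π A B) (long : 3 * n ≤ 6 * length A + 2 * k) where

    ↗A : Linked _<_ A
    ↗A = proj₁ (proj₁ twins)

    A<n : All (_< n) A
    A<n = proj₂ (proj₁ twins)

    ↗B : Linked _<_ B
    ↗B = proj₁ (proj₁ (proj₂ twins))

    B<n : All (_< n) B
    B<n = proj₂ (proj₁ (proj₂ twins))

    A∩B=∅ : ∀ p → p ∈ A → p ∉ B
    A∩B=∅ = proj₁ (proj₂ (proj₂ twins))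

    same-length : length A ≡ length B
    same-length = proj₁ (proj₂ (proj₂ (proj₂ twins)))

    shape-transfer : ∀ {u} → suc u < length A →
      SameBlock (S k) (at B u) (at B (suc u)) → SameBlock (S k) (at A u) (at A (suc u))
    shape-transfer {u} su<A same =
      Equivalence.to (perm-<⇔SameBlock (at<at-suc ↗A su<A) (at-All A<n su<A))
        (sameShape-<-transfer (at π) same-length (proj₂ (proj₂ (proj₂ (proj₂ twins)))) su<A
          (Equivalence.from (perm-<⇔SameBlock (at<at-suc ↗B su<B) (at-All B<n su<B)) same))
      where
      su<B : suc u < length B
      su<B = subst (suc u <_) same-length su<A

    <countIn-B⇒<length-A : ∀ {v p} → v < countIn 0 p B → v < length A
    <countIn-B⇒<length-A v< = <-≤-trans v< (≤-trans (countIn-≤-length 0 _ B) (≤-reflexive (sym same-length)))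

    A-steps-within-B-block : ∀ {i v} → countIn 0 (S k i) B ≤ v → suc v < countIn 0 (S k (suc i)) B →
      SameBlock (S k) (at A v) (at A (suc v))
    A-steps-within-B-block {i} {v} lo≤v sv<hi = shape-transfer (<countIn-B⇒<length-A sv<hi)
      (SameBlock-within (S-mono k) {i} (proj₁ (at-between _ _ ↗B v<B lo≤v (<-trans (n<1+n v) sv<hi)))
                                   (proj₂ (at-between _ _ ↗B sv<B (≤-trans lo≤v (n≤1+n v)) sv<hi)))
      where
      sv<B : suc v < length B
      sv<B = <-≤-trans sv<hi (countIn-≤-length 0 _ B)
      v<B : v < length B
      v<B = <-trans (n<1+n v) sv<B

    A-not-behind-if-enters : ∀ {i} → countIn 0 (S k i) A ≡ countIn 0 (S k i) B →
      countIn 0 (S k i) A < countIn 0 (S k (suc i)) A →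
      ¬ (countIn 0 (S k (suc i)) A < countIn 0 (S k (suc i)) B)
    A-not-behind-if-enters {i} below enters A<B with countIn 0 (S k (suc i)) A in rank≡
    ... | suc u = contradiction (same (suc i) last-inside) (≤⇒≯ next-outside)
      where
      su<A : suc u < length A
      su<A = <countIn-B⇒<length-A A<B
      same : SameBlock (S k) (at A u) (at A (suc u))
      same = A-steps-within-B-block {i} (subst (_≤ u) below (≤-pred enters)) A<B
      last-inside : at A u < S k (suc i)
      last-inside = Equivalence.from (at<⇔<countIn _ ↗A (<-trans (n<1+n u) su<A))
                                     (≤-reflexive (sym rank≡))
      next-outside : S k (suc i) ≤ at A (suc u)
      next-outside = countIn≤⇒≤at _ ↗A su<A (≤-reflexive rank≡)

    B-block-fits-later : ∀ {i} → suc i ≤ m → countIn 0 (S k (suc i)) A ≡ countIn 0 (S k i) B →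
      countIn (S k i) (S k (suc i)) B ≤ xs k (2 + i)
    B-block-fits-later {i} i<m rank-A with countIn (S k i) (S k (suc i)) B in c≡
    ... | zero = z≤n
    ... | suc c = +-cancelˡ-< (at A t) _ _ (begin-strict
      at A t + c            ≤⟨ at+≤at-+ ↗A t c last<A ⟩
      at A (t + c)          <⟨ width ⟩
      at A t + xs k (2 + i) ∎)
      where
      open ≤-Reasoning
      t : ℕ
      t = countIn 0 (S k i) B
      last<rank-B : t + c < countIn 0 (S k (suc i)) B
      last<rank-B = begin-strict
        t + c                                   <⟨ +-monoʳ-< t (n<1+n c) ⟩
        t + suc c                               ≡⟨ cong (t +_) c≡ ⟨
        t + countIn (S k i) (S k (suc i)) B     ≡⟨ countIn-split z≤n (S-mono k (n≤1+n i)) B ⟨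
        countIn 0 (S k (suc i)) B               ∎
      last<A : t + c < length A
      last<A = <countIn-B⇒<length-A last<rank-B
      steps : ∀ d → d < c → SameBlock (S k) (at A (t + d)) (at A (suc (t + d)))
      steps d d<c = A-steps-within-B-block {i} (m≤m+n t d)
        (≤-<-trans (≤-trans (≤-reflexive (sym (+-suc t d))) (+-monoʳ-≤ t d<c)) last<rank-B)
      width : at A (t + c) < at A t + xs k (2 + i)
      width with d , i+d≡m ← m≤n⇒∃[o]m+o≡n (≤-trans (n≤1+n i) i<m) =
        SameBlock-width {a = suc i} (λ _ → S-step-≤ k) d
          (countIn≤⇒≤at _ ↗A (≤-<-trans (m≤m+n t c) last<A) (≤-reflexive rank-A))
          (SameBlock-chain (at A) t c steps)
          (<-≤-trans (at-All A<n last<A) (≤-trans n≤S (≤-reflexive (cong (S k ∘ suc) (sym i+d≡m)))))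

    wasted-block : ∀ {i} → suc i ≤ m → countIn (S k i) (S k (suc i)) A ≡ 0 →
      countIn (S k i) (S k (suc i)) B ≤ xs k (2 + i) → 2 * length A + 2 * k ≤ n
    wasted-block {i} i<m none-in-A c≤xs = +-cancelˡ-≤ c _ _ (begin
      c + (2 * L + 2 * k)            ≡⟨ rearrange c L k ⟩
      L + L + (c + 2 * k)            ≤⟨ +-monoʳ-≤ (L + L) (≤-trans (+-monoˡ-≤ (2 * k) c≤xs)
                                                                   (≤-reflexive (xs-gap (≤-trans (s≤s i<m) m<k)))) ⟩
      L + L + x                      ≡⟨ cong (λ l → L + l + x) same-length ⟩
      L + length B + x               ≤⟨ disjoint-length-bound ↗A ↗B A∩B=∅ A<n B<n lo x hi≤n ⟩
      countIn lo (lo + x) A + countIn lo (lo + x) B + n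
                                     ≡⟨ cong (λ h → countIn lo h A + countIn lo h B + n) (S-suc k i) ⟨
      countIn lo (S k (suc i)) A + c + n
                                     ≡⟨ cong (λ a → a + c + n) none-in-A ⟩
      c + n                          ∎)
      where
      open ≤-Reasoning
      L lo x c : ℕ
      L = length A
      lo = S k i
      x = xs k (suc i)
      c = countIn lo (S k (suc i)) B
      hi≤n : lo + x ≤ n
      hi≤n = ≤-trans (≤-reflexive (sym (S-suc k i))) (<⇒≤ (≤-<-trans (S-mono k i<m) S<n))
      rearrange : ∀ c L k → c + (2 * L + 2 * k) ≡ L + L + (c + 2 * k)
      rearrange = solve-∀

    A-meets-block : ∀ {i} → suc i ≤ m → countIn 0 (S k i) A ≡ countIn 0 (S k i) B →
      countIn 0 (S k i) A < countIn 0 (S k (suc i)) A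
    A-meets-block {i} i<m below = ≰⇒> (λ skips → <⇒≱ m<k (subst (_≤ m) (sym (k≡0 skips)) z≤n))
      where
      open ≤-Reasoning
      t : ℕ
      t = countIn 0 (S k i) A
      split : countIn 0 (S k (suc i)) A ≡ t + countIn (S k i) (S k (suc i)) A
      split = countIn-split z≤n (S-mono k (n≤1+n i)) A
      none-in-A : countIn 0 (S k (suc i)) A ≤ t → countIn (S k i) (S k (suc i)) A ≡ 0
      none-in-A skips = n≤0⇒n≡0 (+-cancelˡ-≤ t _ _ (begin
        t + countIn (S k i) (S k (suc i)) A  ≡⟨ split ⟨
        countIn 0 (S k (suc i)) A            ≤⟨ skips ⟩
        t                                    ≡⟨ +-identityʳ t ⟨
        t + 0                                ∎))
      k≡0 : countIn 0 (S k (suc i)) A ≤ t → k ≡ 0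
      k≡0 skips = short-twins⇒k≡0 {length A} (wasted-block i<m (none-in-A skips) (B-block-fits-later i<m
        (trans split (trans (cong₂ _+_ below (none-in-A skips)) (+-identityʳ _))))) long

    no-rank-lead : ∀ {i} → suc i ≤ m → countIn 0 (S k i) A ≡ countIn 0 (S k i) B →
      ¬ (countIn 0 (S k (suc i)) A < countIn 0 (S k (suc i)) B)
    no-rank-lead {i} i<m below = A-not-behind-if-enters {i} below (A-meets-block i<m below)

  ranks-agree : ∀ {A B} → WeakTwins n π A B → 3 * n ≤ 6 * length A + 2 * k →
    ∀ {i} → i ≤ m → countIn 0 (S k i) A ≡ countIn 0 (S k i) B
  ranks-agree {A} {B} _ _ {zero} _ = trans (countIn-empty 0 A) (sym (countIn-empty 0 B))
  ranks-agree {A} {B} twins long {suc i} i<m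
    with below ← ranks-agree twins long {i} (≤-trans (n≤1+n i) i<m)
    with <-cmp (countIn 0 (S k (suc i)) A) (countIn 0 (S k (suc i)) B)
  ... | tri< A<B _ _ = contradiction A<B (Twins.no-rank-lead twins long i<m below)
  ... | tri≈ _ A≡B _ = A≡B
  ... | tri> _ _ B<A = contradiction B<A
          (Twins.no-rank-lead (WeakTwins-sym {n} {π} twins) long′ {i} i<m (sym below))
    where
    long′ : 3 * n ≤ 6 * length B + 2 * k
    long′ = subst (λ l → 3 * n ≤ 6 * l + 2 * k) (proj₁ (proj₂ (proj₂ (proj₂ twins)))) long

proposition5 : ∃[ N ] ∀ (n : ℕ) → N ≤ n
    → ∀ (k : ℕ) → IsCeilCbrt n k
    → ∀ (k' : ℕ) → IsKPrime n k k'
    → ∀ (A B : List ℕ) → WeakTwins n (perm n k k') A B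
    → 3 * n ≤ 6 * length A + 2 * k
    → ∀ (i : ℕ) → 1 ≤ i → i < k'
    → blockCount k i A ≡ blockCount k i B
proposition5 = 0 , λ where
  n _ k _ zero (() , _) _ _ _ _ _ _ _
  n _ k _ (suc m) k′-min A B twins long (suc i) _ (s≤s i<m) →
    let open Layered k′-min in
    countIn-interval-≡ A B (S-mono k (n≤1+n i))
      (ranks-agree twins long {i} (≤-trans (n≤1+n i) i<m)) (ranks-agree twins long i<m)
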